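{- Let $q$ be an odd prime power and let $a \in \mathbb{F}_q$, $a \neq 0$. The girth of the quadrance graph $D_q(a)$ is $3$ if $3$ is a square in $\mathbb{F}_q$, and $4$ otherwise.
   Context: For $X=(x_1,x_2)$, $Y=(y_1,y_2)\in\mathbb{F}_q^2$ the quadrance is $Q(X,Y)=(y_1-x_1)^2+(y_2-x_2)^2$. For $a\in\mathbb{F}_q$, the quadrance graph $D_q(a)$ has vertex set $\mathbb{F}_q^2$, with distinct $X,Y$ adjacent if and only if $Q(X,Y)=a$. The girth of a graph is the length of a shortest cycle. -}

module Defs where

open import Level using (Level; _⊔_) renaming (suc to lsuc)
open import Algebra.Bundles using (CommutativeRing)
open import Data.Nat using (ℕ; zero; suc; _≤_; _<_; _^_)
open import Data.Nat.Primality using (Prime)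
open import Data.Fin using (Fin; inject₁; fromℕ) renaming (zero to fzero; suc to fsuc)
open import Data.Product using (Σ; ∃; _×_; _,_)
open import Relation.Binary.PropositionalEquality using (_≡_)
open import Relation.Nullary using (¬_)
open import Data.Empty.Polymorphic using (⊥)

IsPrimePower : ℕ → Set
IsPrimePower q = Σ ℕ λ p → Σ ℕ λ k → Prime p × q ≡ p ^ suc k

record FiniteField (c ℓ : Level) : Set (lsuc (c ⊔ ℓ)) where
  field
    commRing : CommutativeRing c ℓ
  open CommutativeRing commRing public
  field
    one≉zero : ¬ (1# ≈ 0#)
    inverse  : ∀ x → ¬ (x ≈ 0#) → ∃ λ y → (x * y) ≈ 1#
    size     : ℕ
    enum     : Fin size → Carrier
    enum-surjective : ∀ x → ∃ λ i → enum i ≈ x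
    enum-injective  : ∀ i j → enum i ≈ enum j → i ≡ j

  Point : Set c
  Point = Carrier × Carrier

  _≈P_ : Point → Point → Set ℓ
  (x₁ , x₂) ≈P (y₁ , y₂) = (x₁ ≈ y₁) × (x₂ ≈ y₂)

  three : Carrier
  three = 1# + 1# + 1#

  IsSquare : Carrier → Set (c ⊔ ℓ)
  IsSquare z = ∃ λ x → (x * x) ≈ z

  quadrance : Point → Point → Carrier
  quadrance (x₁ , x₂) (y₁ , y₂) =
    ((y₁ - x₁) * (y₁ - x₁)) + ((y₂ - x₂) * (y₂ - x₂))

  QAdj : Carrier → Point → Point → Set ℓ
  QAdj a X Y = ¬ (X ≈P Y) × (quadrance X Y ≈ a)

module _ {c ℓ r : Level} {V : Set c} (_≈V_ : V → V → Set ℓ) (Adj : V → V → Set r) where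

  HasCycle : ℕ → Set (c ⊔ ℓ ⊔ r)
  HasCycle zero = ⊥
  HasCycle (suc n) =
    (3 ≤ suc n) ×
    (Σ (Fin (suc n) → V) λ v →
      (∀ i j → ¬ (i ≡ j) → ¬ (v i ≈V v j)) ×
      (∀ (i : Fin n) → Adj (v (inject₁ i)) (v (fsuc i))) ×
      Adj (v (fromℕ n)) (v fzero))

  Girth : ℕ → Set (c ⊔ ℓ ⊔ r)
  Girth g = HasCycle g × (∀ k → k < g → ¬ HasCycle k)

module Submission where

-- Since every element of a finite field is a sum of two squares, there is a
-- point P = (x, y) with Q(O, P) = x² + y² = a.  Turning P by 90° gives the
-- square O, P, P + P⊥, P⊥ of side a whose diagonals have quadrance 2a ≠ 0
-- (q is odd), hence a 4-cycle.  If r² = 3, turning P by 60° (using r and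
-- 1/2) gives an equilateral triangle of side a, hence a 3-cycle.
-- Conversely Archimedes' formula 4·cross² = 4AB − (A + B − C)² turns an
-- equilateral triangle of side a ≠ 0 into (2·cross/a)² = 3.

open import Defs
open import Level using (Level)
open import Data.Nat using (ℕ)
open import Data.Nat.Divisibility using (_∣_)
open import Data.Product using (_×_)
open import Relation.Nullary using (¬_)

open import Algebra.Bundles using (CommutativeRing)
open import Data.Nat as ℕ using (zero; suc)
import Data.Nat.Properties as ℕP
open import Data.Nat.Divisibility using (_∣0; ∣-refl; ∣m∣n⇒∣m+n)
open import Data.Integer as ℤ using (ℤ; +_; -[1+_]; sign; ∣_∣; _◃_; _⊖_)
import Data.Integer.Properties as ℤP
import Data.Sign as Sign
open import Data.Fin as Fin using (Fin; punchIn; punchOut)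
import Data.Fin.Properties as FP
open import Data.Vec using (_∷_; []; lookup)
open import Data.Product using (∃; _,_; proj₁; proj₂)
open import Data.Sum using (_⊎_; inj₁; inj₂; [_,_])
open import Data.Maybe using (Maybe; just; nothing)
open import Data.Empty using (⊥; ⊥-elim)
open import Relation.Nullary using (Dec; yes; no; contradiction)
open import Relation.Nullary.Decidable using (map′)
open import Relation.Binary.Definitions using (tri<; tri≈; tri>)
open import Relation.Binary.PropositionalEquality as ≡ using (_≡_; _≢_)

-- Polynomial identities with integer constants hold in every commutative
-- ring: the canonical map ℤ → R is a ring homomorphism, which is what
-- Algebra.Solver.Ring needs to normalise with integer coefficients.
module IntegerCoefficients {c ℓ : Level} (R : CommutativeRing c ℓ) where
  open CommutativeRing R hiding (zero)
  open import Algebra.Solver.Ring.AlmostCommutativeRing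
    using (fromCommutativeRing; _-Raw-AlmostCommutative⟶_)
  open import Algebra.Properties.Semiring.Mult.TCOptimised semiring
    using (×-homo-+; ×1-homo-*) renaming (_×_ to _·ₙ_)
  open import Algebra.Properties.Ring ring
    using (-‿distribˡ-*; -‿distribʳ-*)
  open import Algebra.Properties.AbelianGroup +-abelianGroup
    using (ε⁻¹≈ε; ⁻¹-involutive; ⁻¹-∙-comm)
  open import Relation.Binary.Reasoning.Setoid setoid

  nat : ℕ → Carrier
  nat n = n ·ₙ 1#

  nat-suc : ∀ n → nat (suc n) ≈ 1# + nat n
  nat-suc = ×-homo-+ 1# 1

  embed : ℤ → Carrier
  embed (+ n)    = nat n
  embed -[1+ n ] = - nat (suc n)

  signed : Sign.Sign → Carrier → Carrier
  signed Sign.+ x = x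
  signed Sign.- x = - x

  signed-cong : ∀ s {x y} → x ≈ y → signed s x ≈ signed s y
  signed-cong Sign.+ x≈y = x≈y
  signed-cong Sign.- x≈y = -‿cong x≈y

  signed-* : ∀ s t x y → signed (s Sign.* t) (x * y) ≈ signed s x * signed t y
  signed-* Sign.+ Sign.+ x y = refl
  signed-* Sign.+ Sign.- x y = -‿distribʳ-* x y
  signed-* Sign.- Sign.+ x y = -‿distribˡ-* x y
  signed-* Sign.- Sign.- x y = begin
    x * y         ≈⟨ ⁻¹-involutive (x * y) ⟨
    - - (x * y)   ≈⟨ -‿cong (-‿distribˡ-* x y) ⟩
    - (- x * y)   ≈⟨ -‿distribʳ-* (- x) y ⟩
    - x * - y     ∎

  embed-◃ : ∀ s n → embed (s ◃ n) ≈ signed s (nat n)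
  embed-◃ Sign.+ zero    = refl
  embed-◃ Sign.- zero    = sym ε⁻¹≈ε
  embed-◃ Sign.+ (suc n) = refl
  embed-◃ Sign.- (suc n) = refl

  embed-sign-abs : ∀ i → embed i ≈ signed (sign i) (nat ∣ i ∣)
  embed-sign-abs (+ zero)  = refl
  embed-sign-abs (+ suc n) = refl
  embed-sign-abs -[1+ n ]    = refl

  embed-* : ∀ i j → embed (i ℤ.* j) ≈ embed i * embed j
  embed-* i j = begin
    embed (i ℤ.* j)                       ≈⟨ embed-◃ s (∣ i ∣ ℕ.* ∣ j ∣) ⟩
    signed s (nat (∣ i ∣ ℕ.* ∣ j ∣))       ≈⟨ signed-cong s (×1-homo-* ∣ i ∣ ∣ j ∣) ⟩
    signed s (nat ∣ i ∣ * nat ∣ j ∣)       ≈⟨ signed-* (sign i) (sign j) _ _ ⟩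
    signed (sign i) (nat ∣ i ∣) * signed (sign j) (nat ∣ j ∣)
                                          ≈⟨ *-cong (embed-sign-abs i) (embed-sign-abs j) ⟨
    embed i * embed j                     ∎
    where s = sign i Sign.* sign j

  cancel-1 : ∀ u v → (1# + u) - (1# + v) ≈ u - v
  cancel-1 u v = begin
    (1# + u) - (1# + v)        ≈⟨ +-congˡ (⁻¹-∙-comm 1# v) ⟨
    (1# + u) + (- 1# + - v)    ≈⟨ +-congʳ (+-comm 1# u) ⟩
    (u + 1#) + (- 1# + - v)    ≈⟨ +-assoc u 1# _ ⟩
    u + (1# + (- 1# + - v))    ≈⟨ +-congˡ (+-assoc 1# (- 1#) (- v)) ⟨
    u + ((1# - 1#) + - v)      ≈⟨ +-congˡ (+-congʳ (-‿inverseʳ 1#)) ⟩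
    u + (0# + - v)             ≈⟨ +-congˡ (+-identityˡ (- v)) ⟩
    u - v                      ∎

  embed-⊖ : ∀ m n → embed (m ⊖ n) ≈ nat m - nat n
  embed-⊖ m zero rewrite ℤP.⊖-≥ {m} {zero} ℕ.z≤n = begin
    nat m          ≈⟨ +-identityʳ (nat m) ⟨
    nat m + 0#     ≈⟨ +-congˡ ε⁻¹≈ε ⟨
    nat m - 0#     ∎
  embed-⊖ zero (suc n) = sym (+-identityˡ _)
  embed-⊖ (suc m) (suc n) rewrite ℤP.[1+m]⊖[1+n]≡m⊖n m n = begin
    embed (m ⊖ n)                ≈⟨ embed-⊖ m n ⟩
    nat m - nat n                ≈⟨ cancel-1 (nat m) (nat n) ⟨
    (1# + nat m) - (1# + nat n)  ≈⟨ +-cong (nat-suc m) (-‿cong (nat-suc n)) ⟨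
    nat (suc m) - nat (suc n) ∎

  embed-+ : ∀ i j → embed (i ℤ.+ j) ≈ embed i + embed j
  embed-+ (+ m)    (+ n)    = ×-homo-+ 1# m n
  embed-+ (+ m)    -[1+ n ] = embed-⊖ m (suc n)
  embed-+ -[1+ m ] (+ n)    = trans (embed-⊖ n (suc m)) (+-comm _ _)
  embed-+ -[1+ m ] -[1+ n ] = begin
    - nat (suc (suc (m ℕ.+ n)))   ≡⟨ ≡.cong (λ k → - nat (suc k)) (ℕP.+-suc m n) ⟨
    - nat (suc m ℕ.+ suc n)       ≈⟨ -‿cong (×-homo-+ 1# (suc m) (suc n)) ⟩
    - (nat (suc m) + nat (suc n)) ≈⟨ ⁻¹-∙-comm _ _ ⟨
    - nat (suc m) - nat (suc n)   ∎

  embed-neg : ∀ i → embed (ℤ.- i) ≈ - embed i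
  embed-neg (+ zero)  = sym ε⁻¹≈ε
  embed-neg (+ suc n) = refl
  embed-neg -[1+ n ]    = sym (⁻¹-involutive _)

  embed-homomorphism : ℤ.+-*-rawRing -Raw-AlmostCommutative⟶ fromCommutativeRing R
  embed-homomorphism = record
    { ⟦_⟧ = embed ; +-homo = embed-+ ; *-homo = embed-* ; -‿homo = embed-neg
    ; 0-homo = refl ; 1-homo = refl }

  embed-≟ : ∀ i j → Maybe (embed i ≈ embed j)
  embed-≟ i j with i ℤ.≟ j
  ... | yes ≡.refl = just refl
  ... | no _       = nothing

  open import Algebra.Solver.Ring ℤ.+-*-rawRing (fromCommutativeRing R)
    embed-homomorphism embed-≟ public
    using (solve; _:=_; _:+_; _:*_; :-_; _:-_; con)

-- A fixed-point-free involution σ of Fin n pairs up the elements, so n is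
-- even: remove the pair {0, σ 0} and recurse on the restriction of σ.
involution-without-fixed-points-even : ∀ n (σ : Fin n → Fin n) →
  (∀ i → σ (σ i) ≡ i) → (∀ i → σ i ≢ i) → 2 ∣ n
involution-without-fixed-points-even zero _ _ _ = 2 ∣0
involution-without-fixed-points-even (suc zero) σ _ free with σ Fin.zero in σ0≡0
... | Fin.zero = ⊥-elim (free Fin.zero σ0≡0)
involution-without-fixed-points-even (suc (suc m)) σ invol free with σ Fin.zero in σ0≡
... | Fin.zero  = ⊥-elim (free Fin.zero σ0≡)
... | Fin.suc j = ∣m∣n⇒∣m+n ∣-refl
                    (involution-without-fixed-points-even m σ′ σ′-invol σ′-free)
  where
  rest : Fin m → Fin (suc (suc m))
  rest k = Fin.suc (punchIn j k)

  rest-injective : ∀ {k l} → rest k ≡ rest l → k ≡ l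
  rest-injective eq = FP.punchIn-injective j _ _ (FP.suc-injective eq)

  σ-pair : σ (Fin.suc j) ≡ Fin.zero
  σ-pair = ≡.trans (≡.cong σ (≡.sym σ0≡)) (invol Fin.zero)

  σrest≢0 : ∀ k → σ (rest k) ≢ Fin.zero
  σrest≢0 k eq = FP.punchInᵢ≢i j k
    (FP.suc-injective (≡.trans (≡.sym (invol (rest k))) (≡.trans (≡.cong σ eq) σ0≡)))

  σrest≢j : ∀ k → σ (rest k) ≢ Fin.suc j
  σrest≢j k eq with ≡.trans (≡.sym (invol (rest k))) (≡.trans (≡.cong σ eq) σ-pair)
  ... | ()

  unrest : (x : Fin (suc (suc m))) → x ≢ Fin.zero → x ≢ Fin.suc j → Fin m
  unrest Fin.zero     x≢0 _   = ⊥-elim (x≢0 ≡.refl)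
  unrest (Fin.suc x) _   x≢j = punchOut {i = j} {j = x} (λ j≡x → x≢j (≡.cong Fin.suc (≡.sym j≡x)))

  rest-unrest : ∀ x x≢0 x≢j → rest (unrest x x≢0 x≢j) ≡ x
  rest-unrest Fin.zero     x≢0 _ = ⊥-elim (x≢0 ≡.refl)
  rest-unrest (Fin.suc x) _   _ = ≡.cong Fin.suc (FP.punchIn-punchOut _)

  σ′ : Fin m → Fin m
  σ′ k = unrest (σ (rest k)) (σrest≢0 k) (σrest≢j k)

  rest-σ′ : ∀ k → rest (σ′ k) ≡ σ (rest k)
  rest-σ′ k = rest-unrest (σ (rest k)) (σrest≢0 k) (σrest≢j k)

  σ′-invol : ∀ k → σ′ (σ′ k) ≡ k
  σ′-invol k = rest-injective
    (≡.trans (rest-σ′ (σ′ k)) (≡.trans (≡.cong σ (rest-σ′ k)) (invol (rest k))))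

  σ′-free : ∀ k → σ′ k ≢ k
  σ′-free k eq = free (rest k) (≡.trans (≡.sym (rest-σ′ k)) (≡.cong rest eq))

injective-endomap-hits : ∀ n (g : Fin n → Fin n) → (∀ i j → g i ≡ g j → i ≡ j) →
  (k : Fin n) → ¬ (∀ i → g i ≢ k)
injective-endomap-hits (suc m) g g-inj k misses =
  let i , j , i<j , same = FP.pigeonhole (ℕP.n<1+n m) (λ i → punchOut (k≢g i))
  in FP.<⇒≢ i<j (g-inj i j (FP.punchOut-injective (k≢g i) (k≢g j) same))
  where
  -- g never hits k, so each g i can be squeezed into Fin m
  k≢g : ∀ i → k ≢ g i
  k≢g i eq = misses i (≡.sym eq)

module FiniteFieldFacts {c ℓ : Level} (F : FiniteField c ℓ) where
  open FiniteField F hiding (zero)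
  open IntegerCoefficients commRing
  open import Algebra.Properties.AbelianGroup +-abelianGroup
    using (inverseˡ-unique; x∙y⁻¹≈ε⇒x≈y; ⁻¹-injective; ε⁻¹≈ε; ⁻¹-involutive;
           identityʳ-unique; ∙-cancelˡ)
  open import Relation.Binary.Reasoning.Setoid setoid

  index : Carrier → Fin size
  index x = proj₁ (enum-surjective x)

  enum-index : ∀ x → enum (index x) ≈ x
  enum-index x = proj₂ (enum-surjective x)

  index-cong : ∀ {x y} → x ≈ y → index x ≡ index y
  index-cong {x} {y} x≈y =
    enum-injective _ _ (trans (enum-index x) (trans x≈y (sym (enum-index y))))

  index-enum : ∀ i → index (enum i) ≡ i
  index-enum i = enum-injective _ _ (enum-index (enum i))

  index-injective : ∀ {x y} → index x ≡ index y → x ≈ y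
  index-injective {x} {y} eq =
    trans (sym (enum-index x)) (trans (reflexive (≡.cong enum eq)) (enum-index y))

  infix 4 _≈?_
  _≈?_ : ∀ x y → Dec (x ≈ y)
  x ≈? y = map′ index-injective index-cong (index x FP.≟ index y)

  no-zero-divisors : ∀ x y → x * y ≈ 0# → x ≈ 0# ⊎ y ≈ 0#
  no-zero-divisors x y xy≈0 with x ≈? 0#
  ... | yes x≈0 = inj₁ x≈0
  ... | no x≉0 with inverse x x≉0
  ... | x⁻¹ , xx⁻¹≈1 = inj₂ (begin
        y              ≈⟨ *-identityˡ y ⟨
        1# * y         ≈⟨ *-congʳ xx⁻¹≈1 ⟨
        (x * x⁻¹) * y  ≈⟨ solve 3 (λ x x⁻¹ y → ((x :* x⁻¹) :* y) := (x⁻¹ :* (x :* y))) refl x x⁻¹ y ⟩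
        x⁻¹ * (x * y)  ≈⟨ *-congˡ xy≈0 ⟩
        x⁻¹ * 0#       ≈⟨ zeroʳ x⁻¹ ⟩
        0#             ∎)

  square-roots : ∀ x y → x * x ≈ y * y → x ≈ y ⊎ x ≈ - y
  square-roots x y x²≈y² with no-zero-divisors (x - y) (x + y) difference-of-squares
    where
    difference-of-squares : (x - y) * (x + y) ≈ 0#
    difference-of-squares = begin
      (x - y) * (x + y)  ≈⟨ solve 2 (λ x y → ((x :- y) :* (x :+ y)) := ((x :* x) :- (y :* y))) refl x y ⟩
      x * x - y * y      ≈⟨ +-congʳ x²≈y² ⟩
      y * y - y * y      ≈⟨ -‿inverseʳ (y * y) ⟩
      0#                 ∎
  ... | inj₁ x-y≈0 = inj₁ (x∙y⁻¹≈ε⇒x≈y x y x-y≈0)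
  ... | inj₂ x+y≈0 = inj₂ (inverseˡ-unique x y x+y≈0)

  two : Carrier
  two = 1# + 1#

  -- In characteristic 2 the translation x ↦ x + 1 is a fixed-point-free
  -- involution, which forces the order of F to be even.
  odd-order⇒two≉0 : ¬ (2 ∣ size) → ¬ (two ≈ 0#)
  odd-order⇒two≉0 odd two≈0 = odd
    (involution-without-fixed-points-even size shift shift-involutive shift-free)
    where
    shift : Fin size → Fin size
    shift i = index (enum i + 1#)

    shift-involutive : ∀ i → shift (shift i) ≡ i
    shift-involutive i = ≡.trans (index-cong (begin
      enum (shift i) + 1#  ≈⟨ +-congʳ (enum-index _) ⟩
      enum i + 1# + 1#     ≈⟨ +-assoc _ _ _ ⟩
      enum i + two         ≈⟨ +-congˡ two≈0 ⟩
      enum i + 0#          ≈⟨ +-identityʳ _ ⟩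
      enum i               ∎)) (index-enum i)

    shift-free : ∀ i → shift i ≢ i
    shift-free i eq = one≉zero (identityʳ-unique (enum i) 1# (begin
      enum i + 1#      ≈⟨ enum-index _ ⟨
      enum (shift i)   ≡⟨ ≡.cong enum eq ⟩
      enum i           ∎))

  Canonical : Carrier → Set
  Canonical x = index x Fin.≤ index (- x)

  canonical? : ∀ x → Dec (Canonical x)
  canonical? x = index x Fin.≤? index (- x)

  negate-swap : ∀ {x y} → x ≈ - y → index (- x) ≡ index y
  negate-swap {x} {y} x≈-y = index-cong (trans (-‿cong x≈-y) (⁻¹-involutive y))

  canonical-unique : ∀ {x y} → Canonical x → Canonical y → x ≈ - y → x ≈ y
  canonical-unique {x} {y} cx cy x≈-y = index-injective (FP.≤-antisym
    (FP.≤-trans cx (FP.≤-reflexive (negate-swap x≈-y)))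
    (FP.≤-trans cy (FP.≤-reflexive (≡.sym (index-cong x≈-y)))))

  noncanonical-unique : ∀ {x y} → ¬ Canonical x → ¬ Canonical y → ¬ (x ≈ - y)
  noncanonical-unique {x} {y} ncx ncy x≈-y = FP.<-irrefl ≡.refl (FP.<-trans
    (≡.subst (Fin._< index x) (negate-swap x≈-y) (ℕP.≰⇒> ncx))
    (≡.subst (Fin._< index y) (≡.sym (index-cong x≈-y)) (ℕP.≰⇒> ncy)))

  zero-canonical : ∀ {x} → x ≈ 0# → Canonical x
  zero-canonical {x} x≈0 =
    FP.≤-reflexive (index-cong (trans x≈0 (sym (trans (-‿cong x≈0) ε⁻¹≈ε))))

  -- If a is not a sum of two squares, then folding each element x to x² if
  -- x is canonical and to a - x² otherwise is an injection F → F avoiding a,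
  -- which the pigeonhole principle forbids.
  module _ (a : Carrier) (not-sum : ∀ x y → ¬ (x * x + y * y ≈ a)) where
    fold : (x : Carrier) → Dec (Canonical x) → Carrier
    fold x (yes _) = x * x
    fold x (no _)  = a - x * x

    complement-not-sum : ∀ x y → ¬ (x * x ≈ a - y * y)
    complement-not-sum x y x²≈a-y² = not-sum x y (begin
      x * x + y * y          ≈⟨ +-congʳ x²≈a-y² ⟩
      a - y * y + y * y      ≈⟨ solve 2 (λ a u → ((a :- u) :+ u) := a) refl a (y * y) ⟩
      a                      ∎)

    fold-injective : ∀ x y dx dy → fold x dx ≈ fold y dy → x ≈ y
    fold-injective x y (yes cx) (yes cy) x²≈y² with square-roots x y x²≈y²
    ... | inj₁ x≈y  = x≈y
    ... | inj₂ x≈-y = canonical-unique cx cy x≈-y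
    fold-injective x y (no ncx) (no ncy) eq
      with square-roots x y (⁻¹-injective (∙-cancelˡ a (- (x * x)) (- (y * y)) eq))
    ... | inj₁ x≈y  = x≈y
    ... | inj₂ x≈-y = ⊥-elim (noncanonical-unique ncx ncy x≈-y)
    fold-injective x y (yes _) (no _) eq = ⊥-elim (complement-not-sum x y eq)
    fold-injective x y (no _) (yes _) eq = ⊥-elim (complement-not-sum y x (sym eq))

    fold-avoids : ∀ x dx → ¬ (fold x dx ≈ a)
    fold-avoids x (yes _) x²≈a =
      not-sum x 0# (trans (+-congˡ (zeroˡ 0#)) (trans (+-identityʳ _) x²≈a))
    fold-avoids x (no ncx) a-x²≈a with no-zero-divisors x x x²≈0
      where
      x²≈0 : x * x ≈ 0#
      x²≈0 = ⁻¹-injective (trans (identityʳ-unique a _ a-x²≈a) (sym ε⁻¹≈ε))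
    ... | inj₁ x≈0 = ncx (zero-canonical x≈0)
    ... | inj₂ x≈0 = ncx (zero-canonical x≈0)

    not-sum-absurd : ⊥
    not-sum-absurd = injective-endomap-hits size fold-index fold-index-injective
      (index a) (λ i eq → fold-avoids (enum i) (canonical? (enum i)) (index-injective eq))
      where
      fold-index : Fin size → Fin size
      fold-index i = index (fold (enum i) (canonical? (enum i)))

      fold-index-injective : ∀ i j → fold-index i ≡ fold-index j → i ≡ j
      fold-index-injective i j eq =
        enum-injective i j (fold-injective (enum i) (enum j)
          (canonical? (enum i)) (canonical? (enum j)) (index-injective eq))

  sum-of-two-squares : ∀ a → ∃ λ x → ∃ λ y → x * x + y * y ≈ a
  sum-of-two-squares a with FP.any? (λ i → FP.any? (λ j → enum i * enum i + enum j * enum j ≈? a))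
  ... | yes (i , j , sum≈a) = enum i , enum j , sum≈a
  ... | no no-pair = ⊥-elim (not-sum-absurd a not-sum)
    where
    not-sum : ∀ x y → ¬ (x * x + y * y ≈ a)
    not-sum x y sum≈a = no-pair (index x , index y , trans
      (+-cong (*-cong (enum-index x) (enum-index x)) (*-cong (enum-index y) (enum-index y)))
      sum≈a)

module Plane {c ℓ : Level} (F : FiniteField c ℓ) where
  open FiniteField F hiding (zero)
  open FiniteFieldFacts F using (two)
  open IntegerCoefficients commRing
  open import Relation.Binary.Reasoning.Setoid setoid

  ≈P-sym : ∀ {X Y} → X ≈P Y → Y ≈P X
  ≈P-sym (x₁≈y₁ , x₂≈y₂) = sym x₁≈y₁ , sym x₂≈y₂

  origin : Point
  origin = 0# , 0#

  norm : Point → Carrier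
  norm (x , y) = x * x + y * y

  quadrance-sym : ∀ X Y → quadrance X Y ≈ quadrance Y X
  quadrance-sym (x₁ , x₂) (y₁ , y₂) = solve 4 (λ x₁ x₂ y₁ y₂ →
    (((y₁ :- x₁) :* (y₁ :- x₁)) :+ ((y₂ :- x₂) :* (y₂ :- x₂))) :=
    (((x₁ :- y₁) :* (x₁ :- y₁)) :+ ((x₂ :- y₂) :* (x₂ :- y₂)))) refl x₁ x₂ y₁ y₂

  quadrance-origin : ∀ P → quadrance origin P ≈ norm P
  quadrance-origin (x , y) = solve 2 (λ x y →
    (((x :- con (+ 0)) :* (x :- con (+ 0))) :+ ((y :- con (+ 0)) :* (y :- con (+ 0)))) :=
    ((x :* x) :+ (y :* y))) refl x y

  quadrance≉0⇒distinct : ∀ X Y → ¬ (quadrance X Y ≈ 0#) → ¬ (X ≈P Y)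
  quadrance≉0⇒distinct (x₁ , x₂) (y₁ , y₂) Q≉0 (x₁≈y₁ , x₂≈y₂) = Q≉0 (begin
    (y₁ - x₁) * (y₁ - x₁) + (y₂ - x₂) * (y₂ - x₂)
      ≈⟨ +-cong (*-cong d₁ d₁) (*-cong d₂ d₂) ⟩
    (y₁ - y₁) * (y₁ - y₁) + (y₂ - y₂) * (y₂ - y₂)
      ≈⟨ solve 2 (λ u v → (((u :- u) :* (u :- u)) :+ ((v :- v) :* (v :- v))) := con (+ 0)) refl y₁ y₂ ⟩
    0# ∎)
    where
    d₁ : y₁ - x₁ ≈ y₁ - y₁
    d₁ = +-congˡ (-‿cong x₁≈y₁)
    d₂ : y₂ - x₂ ≈ y₂ - y₂
    d₂ = +-congˡ (-‿cong x₂≈y₂)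

  adjacent : ∀ {a X Y} → ¬ (a ≈ 0#) → quadrance X Y ≈ a → QAdj a X Y
  adjacent {a} {X} {Y} a≉0 Q≈a =
    quadrance≉0⇒distinct X Y (λ Q≈0 → a≉0 (trans (sym Q≈a) Q≈0)) , Q≈a

  -- twice the signed area of the triangle XYZ
  cross : Point → Point → Point → Carrier
  cross (x₁ , x₂) (y₁ , y₂) (z₁ , z₂) = (y₁ - x₁) * (z₂ - x₂) - (y₂ - x₂) * (z₁ - x₁)

  four : Carrier
  four = two * two

  archimedes : ∀ X Y Z →
    four * (cross X Y Z * cross X Y Z) ≈
      four * (quadrance X Y * quadrance X Z)
      - (quadrance X Y + quadrance X Z - quadrance Y Z) * (quadrance X Y + quadrance X Z - quadrance Y Z)
  archimedes (x₁ , x₂) (y₁ , y₂) (z₁ , z₂) = solve 6 (λ x₁ x₂ y₁ y₂ z₁ z₂ →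
    let Q = λ a₁ a₂ b₁ b₂ → ((b₁ :- a₁) :* (b₁ :- a₁)) :+ ((b₂ :- a₂) :* (b₂ :- a₂))
        D = ((y₁ :- x₁) :* (z₂ :- x₂)) :- ((y₂ :- x₂) :* (z₁ :- x₁))
        A = Q x₁ x₂ y₁ y₂ ; B = Q x₁ x₂ z₁ z₂ ; C = Q y₁ y₂ z₁ z₂
        four = con (+ 2) :* con (+ 2)
    in (four :* (D :* D)) := ((four :* (A :* B)) :- ((A :+ B :- C) :* (A :+ B :- C))))
    refl x₁ x₂ y₁ y₂ z₁ z₂

  -- An equilateral triangle of nonzero side a has 4·cross² = 3a², so 3 is
  -- the square of 2·cross/a.
  equilateral⇒three-square : ∀ {a} → ¬ (a ≈ 0#) → ∀ X Y Z →
    quadrance X Y ≈ a → quadrance X Z ≈ a → quadrance Y Z ≈ a → IsSquare three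
  equilateral⇒three-square {a} a≉0 X Y Z A≈a B≈a C≈a = t , t²≈3
    where
    D : Carrier
    D = cross X Y Z
    b : Carrier
    b = proj₁ (inverse a a≉0)
    ab≈1 : a * b ≈ 1#
    ab≈1 = proj₂ (inverse a a≉0)
    t : Carrier
    t = (two * D) * b
    A+B-C≈a : quadrance X Y + quadrance X Z - quadrance Y Z ≈ a + a - a
    A+B-C≈a = +-cong (+-cong A≈a B≈a) (-‿cong C≈a)
    t²≈3 : t * t ≈ three
    t²≈3 = begin
      t * t
        ≈⟨ solve 2 (λ D b → (((con (+ 2) :* D) :* b) :* ((con (+ 2) :* D) :* b)) :=
             (((con (+ 2) :* con (+ 2)) :* (D :* D)) :* (b :* b))) refl D b ⟩
      (four * (D * D)) * (b * b)
        ≈⟨ *-congʳ (archimedes X Y Z) ⟩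
      (four * (quadrance X Y * quadrance X Z)
        - (quadrance X Y + quadrance X Z - quadrance Y Z) * (quadrance X Y + quadrance X Z - quadrance Y Z)) * (b * b)
        ≈⟨ *-congʳ (+-cong (*-congˡ (*-cong A≈a B≈a)) (-‿cong (*-cong A+B-C≈a A+B-C≈a))) ⟩
      (four * (a * a) - (a + a - a) * (a + a - a)) * (b * b)
        ≈⟨ solve 2 (λ a b → ((((con (+ 2) :* con (+ 2)) :* (a :* a)) :- (((a :+ a) :- a) :* ((a :+ a) :- a))) :* (b :* b)) :=
             (con (+ 3) :* ((a :* b) :* (a :* b)))) refl a b ⟩
      three * ((a * b) * (a * b))
        ≈⟨ *-congˡ (*-cong ab≈1 ab≈1) ⟩
      three * (1# * 1#)
        ≈⟨ solve 0 ((con (+ 3) :* (con (+ 1) :* con (+ 1))) := con (+ 3)) refl ⟩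
      three ∎

  triangle⇒three-square : ∀ {a} → ¬ (a ≈ 0#) → HasCycle _≈P_ (QAdj a) 3 → IsSquare three
  triangle⇒three-square a≉0 (_ , u , _ , path , closing) =
    equilateral⇒three-square a≉0 (u Fin.zero) (u (Fin.suc Fin.zero)) (u (Fin.suc (Fin.suc Fin.zero)))
      (proj₂ (path Fin.zero))
      (trans (quadrance-sym _ _) (proj₂ closing))
      (proj₂ (path (Fin.suc Fin.zero)))

  -- P turned by 60° about the origin, given r with r² = 3 and h with 2h = 1
  turn60 : Carrier → Carrier → Point → Point
  turn60 r h (x , y) = h * (x - r * y) , h * (y + r * x)

  turn60-side : ∀ {r h} → r * r ≈ three → two * h ≈ 1# → ∀ P →
    quadrance P (turn60 r h P) ≈ norm P
  turn60-side {r} {h} r²≈3 2h≈1 (x , y) = begin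
    quadrance (x , y) (turn60 r h (x , y))
      ≈⟨ solve 4 (λ x y r h →
           ((((h :* (x :- (r :* y))) :- x) :* ((h :* (x :- (r :* y))) :- x)) :+
            (((h :* (y :+ (r :* x))) :- y) :* ((h :* (y :+ (r :* x))) :- y)))
           := ((((h :- con (+ 1)) :* (h :- con (+ 1))) :+ ((h :* h) :* (r :* r))) :* ((x :* x) :+ (y :* y))))
           refl x y r h ⟩
    ((h - 1#) * (h - 1#) + (h * h) * (r * r)) * norm (x , y)
      ≈⟨ *-congʳ (+-congˡ (*-congˡ r²≈3)) ⟩
    ((h - 1#) * (h - 1#) + (h * h) * three) * norm (x , y)
      ≈⟨ solve 2 (λ h n → ((((h :- con (+ 1)) :* (h :- con (+ 1))) :+ ((h :* h) :* con (+ 3))) :* n)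
           := (((((con (+ 2) :* h) :* (con (+ 2) :* h)) :- (con (+ 2) :* h)) :+ con (+ 1)) :* n))
           refl h (norm (x , y)) ⟩
    ((two * h) * (two * h) - two * h + 1#) * norm (x , y)
      ≈⟨ *-congʳ (+-congʳ (+-cong (*-cong 2h≈1 2h≈1) (-‿cong 2h≈1))) ⟩
    (1# * 1# - 1# + 1#) * norm (x , y)
      ≈⟨ solve 1 (λ n → ((((con (+ 1) :* con (+ 1)) :- con (+ 1)) :+ con (+ 1)) :* n) := n)
           refl (norm (x , y)) ⟩
    norm (x , y) ∎

  turn60-radius : ∀ {r h} → r * r ≈ three → two * h ≈ 1# → ∀ P →
    quadrance (turn60 r h P) origin ≈ norm P
  turn60-radius {r} {h} r²≈3 2h≈1 (x , y) = begin
    quadrance (turn60 r h (x , y)) origin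
      ≈⟨ solve 4 (λ x y r h →
           (((con (+ 0) :- (h :* (x :- (r :* y)))) :* (con (+ 0) :- (h :* (x :- (r :* y))))) :+
            ((con (+ 0) :- (h :* (y :+ (r :* x)))) :* (con (+ 0) :- (h :* (y :+ (r :* x))))))
           := (((h :* h) :* (con (+ 1) :+ (r :* r))) :* ((x :* x) :+ (y :* y))))
           refl x y r h ⟩
    ((h * h) * (1# + r * r)) * norm (x , y)
      ≈⟨ *-congʳ (*-congˡ (+-congˡ r²≈3)) ⟩
    ((h * h) * (1# + three)) * norm (x , y)
      ≈⟨ solve 2 (λ h n → (((h :* h) :* (con (+ 1) :+ con (+ 3))) :* n)
           := (((con (+ 2) :* h) :* (con (+ 2) :* h)) :* n)) refl h (norm (x , y)) ⟩
    ((two * h) * (two * h)) * norm (x , y)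
      ≈⟨ *-congʳ (*-cong 2h≈1 2h≈1) ⟩
    (1# * 1#) * norm (x , y)
      ≈⟨ solve 1 (λ n → ((con (+ 1) :* con (+ 1)) :* n) := n) refl (norm (x , y)) ⟩
    norm (x , y) ∎

  turn90 : Point → Point
  turn90 (x , y) = - y , x

  _⊕_ : Point → Point → Point
  (x₁ , x₂) ⊕ (y₁ , y₂) = x₁ + y₁ , x₂ + y₂

  square-side₁ : ∀ P → quadrance P (P ⊕ turn90 P) ≈ norm P
  square-side₁ (x , y) = solve 2 (λ x y →
    ((((x :- y) :- x) :* ((x :- y) :- x)) :+ (((y :+ x) :- y) :* ((y :+ x) :- y))) :=
    ((x :* x) :+ (y :* y))) refl x y

  square-side₂ : ∀ P → quadrance (P ⊕ turn90 P) (turn90 P) ≈ norm P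
  square-side₂ (x , y) = solve 2 (λ x y →
    ((((:- y) :- (x :- y)) :* ((:- y) :- (x :- y))) :+ ((x :- (y :+ x)) :* (x :- (y :+ x)))) :=
    ((x :* x) :+ (y :* y))) refl x y

  square-side₃ : ∀ P → quadrance (turn90 P) origin ≈ norm P
  square-side₃ (x , y) = solve 2 (λ x y →
    (((con (+ 0) :- (:- y)) :* (con (+ 0) :- (:- y))) :+ ((con (+ 0) :- x) :* (con (+ 0) :- x))) :=
    ((x :* x) :+ (y :* y))) refl x y

  square-diagonal₁ : ∀ P → quadrance origin (P ⊕ turn90 P) ≈ two * norm P
  square-diagonal₁ (x , y) = solve 2 (λ x y →
    ((((x :- y) :- con (+ 0)) :* ((x :- y) :- con (+ 0))) :+
     (((y :+ x) :- con (+ 0)) :* ((y :+ x) :- con (+ 0)))) :=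
    (con (+ 2) :* ((x :* x) :+ (y :* y)))) refl x y

  square-diagonal₂ : ∀ P → quadrance P (turn90 P) ≈ two * norm P
  square-diagonal₂ (x , y) = solve 2 (λ x y →
    ((((:- y) :- x) :* ((:- y) :- x)) :+ ((x :- y) :* (x :- y))) :=
    (con (+ 2) :* ((x :* x) :+ (y :* y)))) refl x y

module Cycles {c ℓ r : Level} {V : Set c} (_≈_ : V → V → Set ℓ) (Adj : V → V → Set r) where

  no-short-cycle : ∀ k → k ℕ.< 3 → ¬ HasCycle _≈_ Adj k
  no-short-cycle zero    _   ()
  no-short-cycle (suc n) k<3 (3≤k , _) = ℕP.<⇒≱ k<3 3≤k

  module _ (≈-sym : ∀ {x y} → x ≈ y → y ≈ x) (adj⇒≉ : ∀ {x y} → Adj x y → ¬ (x ≈ y)) where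

    distinct-from-ordered : ∀ {n} (v : Fin n → V) →
      (∀ {i j} → i Fin.< j → ¬ (v i ≈ v j)) → ∀ i j → i ≢ j → ¬ (v i ≈ v j)
    distinct-from-ordered v ordered i j i≢j with FP.<-cmp i j
    ... | tri< i<j _ _ = ordered i<j
    ... | tri≈ _ i≡j _ = contradiction i≡j i≢j
    ... | tri> _ _ j<i = λ vi≈vj → ordered j<i (≈-sym vi≈vj)

    adj⇒≉′ : ∀ {x y} → Adj x y → ¬ (y ≈ x)
    adj⇒≉′ xy y≈x = adj⇒≉ xy (≈-sym y≈x)

    triangle-girth : ∀ {x y z} → Adj x y → Adj y z → Adj z x → Girth _≈_ Adj 3
    triangle-girth {x} {y} {z} xy yz zx = (ℕP.≤-refl , v , distinct , path , zx) , no-short-cycle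
      where
      v : Fin 3 → V
      v = lookup (x ∷ y ∷ z ∷ [])

      ordered : ∀ {i j} → i Fin.< j → ¬ (v i ≈ v j)
      ordered {Fin.zero}          {Fin.suc Fin.zero}          _ = adj⇒≉ xy
      ordered {Fin.zero}          {Fin.suc (Fin.suc Fin.zero)} _ = adj⇒≉′ zx
      ordered {Fin.suc Fin.zero}  {Fin.suc (Fin.suc Fin.zero)} _ = adj⇒≉ yz
      ordered {Fin.suc Fin.zero}  {Fin.suc Fin.zero}          (ℕ.s≤s ())
      ordered {Fin.suc (Fin.suc _)} {Fin.suc (Fin.suc Fin.zero)} (ℕ.s≤s (ℕ.s≤s ()))

      distinct : ∀ i j → i ≢ j → ¬ (v i ≈ v j)
      distinct = distinct-from-ordered v ordered

      path : ∀ i → Adj (v (Fin.inject₁ i)) (v (Fin.suc i))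
      path Fin.zero             = xy
      path (Fin.suc Fin.zero)   = yz

    square-girth : ∀ {w₀ w₁ w₂ w₃} → Adj w₀ w₁ → Adj w₁ w₂ → Adj w₂ w₃ → Adj w₃ w₀ →
      ¬ (w₀ ≈ w₂) → ¬ (w₁ ≈ w₃) → ¬ HasCycle _≈_ Adj 3 → Girth _≈_ Adj 4
    square-girth {w₀} {w₁} {w₂} {w₃} a₀₁ a₁₂ a₂₃ a₃₀ w₀≉w₂ w₁≉w₃ no-triangle =
      (ℕP.m≤n⇒m≤1+n ℕP.≤-refl , w , distinct , path , a₃₀) , shorter
      where
      w : Fin 4 → V
      w = lookup (w₀ ∷ w₁ ∷ w₂ ∷ w₃ ∷ [])

      ordered : ∀ {i j} → i Fin.< j → ¬ (w i ≈ w j)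
      ordered {Fin.zero} {Fin.suc Fin.zero} _ = adj⇒≉ a₀₁
      ordered {Fin.zero} {Fin.suc (Fin.suc Fin.zero)} _ = w₀≉w₂
      ordered {Fin.zero} {Fin.suc (Fin.suc (Fin.suc Fin.zero))} _ = adj⇒≉′ a₃₀
      ordered {Fin.suc Fin.zero} {Fin.suc (Fin.suc Fin.zero)} _ = adj⇒≉ a₁₂
      ordered {Fin.suc Fin.zero} {Fin.suc (Fin.suc (Fin.suc Fin.zero))} _ = w₁≉w₃
      ordered {Fin.suc (Fin.suc Fin.zero)} {Fin.suc (Fin.suc (Fin.suc Fin.zero))} _ = adj⇒≉ a₂₃
      ordered {Fin.suc Fin.zero} {Fin.suc Fin.zero} (ℕ.s≤s ())
      ordered {Fin.suc (Fin.suc _)} {Fin.suc Fin.zero} (ℕ.s≤s ())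
      ordered {Fin.suc (Fin.suc _)} {Fin.suc (Fin.suc Fin.zero)} (ℕ.s≤s (ℕ.s≤s ()))
      ordered {Fin.suc (Fin.suc (Fin.suc _))} {Fin.suc (Fin.suc (Fin.suc Fin.zero))} (ℕ.s≤s (ℕ.s≤s (ℕ.s≤s ())))

      distinct : ∀ i j → i ≢ j → ¬ (w i ≈ w j)
      distinct = distinct-from-ordered w ordered

      path : ∀ i → Adj (w (Fin.inject₁ i)) (w (Fin.suc i))
      path Fin.zero                     = a₀₁
      path (Fin.suc Fin.zero)           = a₁₂
      path (Fin.suc (Fin.suc Fin.zero)) = a₂₃

      shorter : ∀ k → k ℕ.< 4 → ¬ HasCycle _≈_ Adj k
      shorter k k<4 with ℕP.m<1+n⇒m<n∨m≡n k<4
      ... | inj₁ k<3  = no-short-cycle k k<3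
      ... | inj₂ ≡.refl = no-triangle

theorem1 : {c ℓ : Level} (F : FiniteField c ℓ) →
    IsPrimePower (FiniteField.size F) → ¬ (2 ∣ FiniteField.size F) →
    (a : FiniteField.Carrier F) → ¬ (FiniteField._≈_ F a (FiniteField.0# F)) →
    (FiniteField.IsSquare F (FiniteField.three F) →
       Girth (FiniteField._≈P_ F) (FiniteField.QAdj F a) 3) ×
    (¬ FiniteField.IsSquare F (FiniteField.three F) →
       Girth (FiniteField._≈P_ F) (FiniteField.QAdj F a) 4)
theorem1 F _ odd-order a a≉0 = girth-3 , girth-4
  where
  open FiniteField F hiding (zero)
  open FiniteFieldFacts F using (two; odd-order⇒two≉0; no-zero-divisors; sum-of-two-squares)
  open Plane F
  open Cycles _≈P_ (QAdj a) using (triangle-girth; square-girth)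

  two≉0 : ¬ (two ≈ 0#)
  two≉0 = odd-order⇒two≉0 odd-order

  P : Point
  P = proj₁ (sum-of-two-squares a) , proj₁ (proj₂ (sum-of-two-squares a))

  |P|≈a : norm P ≈ a
  |P|≈a = proj₂ (proj₂ (sum-of-two-squares a))

  edge : ∀ {X Y} → quadrance X Y ≈ norm P → QAdj a X Y
  edge Q≈|P| = adjacent a≉0 (trans Q≈|P| |P|≈a)

  girth-3 : IsSquare three → Girth _≈P_ (QAdj a) 3
  girth-3 (r , r²≈3) = triangle-girth ≈P-sym proj₁ (edge (quadrance-origin P))
    (edge (turn60-side r²≈3 2h≈1 P)) (edge (turn60-radius r²≈3 2h≈1 P))
    where
    2h≈1 : two * proj₁ (inverse two two≉0) ≈ 1#
    2h≈1 = proj₂ (inverse two two≉0)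

  girth-4 : ¬ IsSquare three → Girth _≈P_ (QAdj a) 4
  girth-4 no-root = square-girth ≈P-sym proj₁
    (edge (quadrance-origin P)) (edge (square-side₁ P)) (edge (square-side₂ P)) (edge (square-side₃ P))
    (diagonal (square-diagonal₁ P)) (diagonal (square-diagonal₂ P))
    (λ triangle → no-root (triangle⇒three-square a≉0 triangle))
    where
    diagonal : ∀ {X Y} → quadrance X Y ≈ two * norm P → ¬ (X ≈P Y)
    diagonal {X} {Y} Q≈2|P| = quadrance≉0⇒distinct X Y λ Q≈0 →
      [ two≉0 , (λ |P|≈0 → a≉0 (trans (sym |P|≈a) |P|≈0)) ]
        (no-zero-divisors two (norm P) (trans (sym Q≈2|P|) Q≈0))
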